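{- Let $f:\{0,1\}^n\to\{0,1\}$. If there exist $u,v\in\{0,1\}^n$ and $i\in[n]$ with $u_i=0$, $v_i=1$, $u_j=v_j$ for all $j\ne i$, and $f(u)=1$, $f(v)=0$, then every orientation $\beta$ of $f$ has $\beta_i=1$.
   Context: $f$ has orientation $\beta\in\{0,1\}^n$ if there is a monotone $h:\{0,1\}^{2n}\to\{0,1\}$ with $f(x)=h(x,x\oplus\beta)$ for all $x\in\{0,1\}^n$. -}

module Defs where

open import Data.Nat using (ℕ; _+_)
open import Data.Fin using (Fin)
open import Data.Bool using (Bool; _≤_; _xor_)
open import Data.Vec.Functional using (_++_; zipWith)
open import Data.Product using (Σ; _×_)
open import Relation.Binary.PropositionalEquality using (_≡_)

-- Points of {0,1}^n, with 0 = false, 1 = true.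
Cube : ℕ → Set
Cube n = Fin n → Bool

BoolFn : ℕ → Set
BoolFn n = Cube n → Bool

_≤ᶜ_ : {n : ℕ} → Cube n → Cube n → Set
x ≤ᶜ y = ∀ i → x i ≤ y i

Monotone : {n : ℕ} → BoolFn n → Set
Monotone {n} h = ∀ (x y : Cube n) → x ≤ᶜ y → h x ≤ h y

_⊕_ : {n : ℕ} → Cube n → Cube n → Cube n
x ⊕ y = zipWith _xor_ x y

HasOrientation : {n : ℕ} → BoolFn n → Cube n → Set
HasOrientation {n} f β =
  Σ (BoolFn (n + n)) λ h → Monotone h × (∀ (x : Cube n) → f x ≡ h (x ++ (x ⊕ β)))

module Submission where

-- If f has orientation β via the monotone h, then
-- f x = h (x , x ⊕ β) is non-decreasing along every step x ≤ y for which
-- also x ⊕ β ≤ y ⊕ β.  The edge u → v of the cube raises coordinate i from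
-- 0 to 1 and fixes the others; if β i were 0, xoring with β would keep it an
-- upward edge (coordinate i is untouched and the others stay equal), so
-- monotonicity would force f u ≤ f v, i.e. 1 ≤ 0.  Hence β i = 1.

open import Defs
open import Data.Nat using (ℕ)
open import Data.Fin using (Fin; splitAt; _≟_)
open import Data.Bool using (Bool; true; false; _xor_)
import Data.Bool as B
open import Data.Bool.Properties using (≤-reflexive; xor-identityʳ)
open import Data.Sum using (inj₁; inj₂)
open import Data.Product using (_,_)
open import Data.Vec.Functional using (_++_)
open import Relation.Nullary using (yes; no)
open import Relation.Binary.PropositionalEquality
  using (_≡_; _≢_; refl; sym; subst₂; cong)

++-monotone : ∀ {m n} {x x' : Cube m} {y y' : Cube n}
  → x ≤ᶜ x' → y ≤ᶜ y' → (x ++ y) ≤ᶜ (x' ++ y')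
++-monotone {m} x≤x' y≤y' k with splitAt m k
... | inj₁ a = x≤x' a
... | inj₂ b = y≤y' b

single-step-≤ᶜ : ∀ {n} {u v : Cube n} (i : Fin n)
  → u i B.≤ v i → (∀ j → j ≢ i → u j ≡ v j) → u ≤ᶜ v
single-step-≤ᶜ {u = u} {v} i ui≤vi elsewhere j with j ≟ i
... | yes refl = ui≤vi
... | no j≢i = ≤-reflexive (elsewhere j j≢i)

⊕-preserves-step : ∀ {n} {u v : Cube n} (β : Cube n) (i : Fin n)
  → β i ≡ false → u i B.≤ v i → (∀ j → j ≢ i → u j ≡ v j)
  → (u ⊕ β) ≤ᶜ (v ⊕ β)
⊕-preserves-step {u = u} {v} β i βi≡0 ui≤vi elsewhere =
  single-step-≤ᶜ i step-at-i (λ j j≢i → cong (_xor β j) (elsewhere j j≢i))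
  where
  step-at-i : (u i xor β i) B.≤ (v i xor β i)
  step-at-i rewrite βi≡0 | xor-identityʳ (u i) | xor-identityʳ (v i) = ui≤vi

oriented-monotone : ∀ {n} {f : BoolFn n} {β : Cube n} → HasOrientation f β
  → ∀ {x y : Cube n} → x ≤ᶜ y → (x ⊕ β) ≤ᶜ (y ⊕ β) → f x B.≤ f y
oriented-monotone (h , h-mono , f≡h) {x} {y} x≤y x⊕β≤y⊕β =
  subst₂ B._≤_ (sym (f≡h x)) (sym (f≡h y))
    (h-mono _ _ (++-monotone x≤y x⊕β≤y⊕β))

proposition1 : (n : ℕ) (f : BoolFn n) (u v : Cube n) (i : Fin n)
    → u i ≡ false → v i ≡ true → (∀ j → j ≢ i → u j ≡ v j)
    → f u ≡ true → f v ≡ false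
    → ∀ (β : Cube n) → HasOrientation f β → β i ≡ true
proposition1 n f u v i ui≡0 vi≡1 elsewhere fu≡1 fv≡0 β orient with β i in βi
... | true = refl
... | false = one≰zero fu≤fv
  where
  ui≤vi : u i B.≤ v i
  ui≤vi = subst₂ B._≤_ (sym ui≡0) (sym vi≡1) B.f≤t

  fu≤fv : f u B.≤ f v
  fu≤fv = oriented-monotone orient (single-step-≤ᶜ i ui≤vi elsewhere)
                                   (⊕-preserves-step β i βi ui≤vi elsewhere)

  one≰zero : f u B.≤ f v → false ≡ true
  one≰zero le with subst₂ B._≤_ fu≡1 fv≡0 le
  ... | ()
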